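{- Define integers $d_2 = 4$ and $d_j = j^{d_{j-1}/(j-1)}$ for $j \ge 3$. Then for every $j \ge 5$ we have $d_j > 2 d_{j-1}^2$. -}

module Defs where

open import Data.Nat using (ℕ; zero; suc; _^_; _/_)

-- d 2 = 4, d j = j ^ (d (j-1) / (j-1)) for j ≥ 3.
-- Values at j = 0, 1 are unused junk (set to 0).
d : ℕ → ℕ
d zero = 0
d (suc zero) = 0
d (suc (suc zero)) = 4
d (suc (suc (suc k))) = suc (suc (suc k)) ^ (d (suc (suc k)) / suc (suc k))

{-# OPTIONS --safe #-}
-- With e_j = d_{j-1}/(j-1) we have d_j = j^{e_j}, and since d_{j-1} is itself a power of j-1,
-- e_j = (j-1)^{e_{j-1}-1}. Inductively e_j ≥ 3 for j ≥ 4, so for m = j-1 ≥ 4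
--   2 d_m² = 2 m^{2e_m} ≤ m^{2e_m+1} < m^{m^{e_m-1}} ≤ (m+1)^{e_{m+1}} = d_{m+1},
-- where the strict step is 2e+1 < 4^{e-1} ≤ m^{e-1} for e ≥ 3.
module Submission where

open import Data.Nat using (ℕ; zero; suc; _+_; _*_; _^_; _∸_; _/_; _≤_; _<_; z≤n; s≤s; NonZero)
open import Defs using (d)
open import Data.Nat.Properties
open import Data.Nat.DivMod using (m*n/n≡m)
open import Data.Product using (_,_)
open import Relation.Binary.PropositionalEquality using (_≡_; sym; trans; cong; subst)

m^[1+n]/m≡m^n : ∀ m n .{{_ : NonZero m}} → m ^ suc n / m ≡ m ^ n
m^[1+n]/m≡m^n m n = trans (cong (_/ m) (*-comm m (m ^ n))) (m*n/n≡m (m ^ n) m)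

d[3+n]/[3+n]≥3 : ∀ n → 3 ≤ d (3 + n) / (3 + n)
d[3+n]/[3+n]≥3 zero = ≤-refl
d[3+n]/[3+n]≥3 (suc n) with b , 3+b≡e ← m≤n⇒∃[o]m+o≡n (d[3+n]/[3+n]≥3 n) = begin
  3                             ≤⟨ m≤m+n 3 (suc n) ⟩
  m                             ≤⟨ m≤m*n m (m ^ suc b) {{m^n≢0 m (suc b)}} ⟩
  m ^ (2 + b)                   ≡⟨ sym (m^[1+n]/m≡m^n m (2 + b)) ⟩
  m ^ (3 + b) / m               ≡⟨ cong (λ e → m ^ e / m) 3+b≡e ⟩
  m ^ (d (3 + n) / (3 + n)) / m ∎
  where
  m = 4 + n
  open ≤-Reasoning

1+[3+b]*2<4^[2+b] : ∀ b → suc ((3 + b) * 2) < 4 ^ (2 + b)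
1+[3+b]*2<4^[2+b] zero = m≤m+n 8 8
1+[3+b]*2<4^[2+b] (suc b) = begin-strict
  2 + x <⟨ +-monoʳ-< 2 x<y ⟩
  2 + y ≤⟨ +-monoˡ-≤ y (≤-trans (m≤m+n 2 ((3 + b) * 2)) x<y) ⟩
  y + y ≤⟨ +-monoʳ-≤ y (m≤m+n y (2 * y)) ⟩
  4 * y ∎
  where
  x = suc ((3 + b) * 2)
  y = 4 ^ (2 + b)
  x<y : x < y
  x<y = 1+[3+b]*2<4^[2+b] b
  open ≤-Reasoning

2*[m^[3+b]]^2<[1+m]^[m^[3+b]/m] : ∀ m b .{{_ : NonZero m}} → 4 ≤ m →
                                   2 * (m ^ (3 + b)) ^ 2 < suc m ^ (m ^ (3 + b) / m)
2*[m^[3+b]]^2<[1+m]^[m^[3+b]/m] m b 4≤m = begin-strict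
  2 * (m ^ (3 + b)) ^ 2   ≡⟨ cong (2 *_) (^-*-assoc m (3 + b) 2) ⟩
  2 * m ^ ((3 + b) * 2)   ≤⟨ *-monoˡ-≤ (m ^ ((3 + b) * 2)) 2≤m ⟩
  m ^ suc ((3 + b) * 2)   <⟨ ^-monoʳ-< m 2≤m (≤-trans (1+[3+b]*2<4^[2+b] b) (^-monoˡ-≤ (2 + b) 4≤m)) ⟩
  m ^ (m ^ (2 + b))       ≤⟨ ^-monoˡ-≤ (m ^ (2 + b)) (n≤1+n m) ⟩
  suc m ^ (m ^ (2 + b))   ≡⟨ cong (suc m ^_) (sym (m^[1+n]/m≡m^n m (2 + b))) ⟩
  suc m ^ (m ^ (3 + b) / m) ∎
  where
  2≤m : 2 ≤ m
  2≤m = ≤-trans (s≤s (s≤s z≤n)) 4≤m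
  open ≤-Reasoning

lemma1 : ∀ (j : ℕ) → 5 ≤ j → 2 * d (j ∸ 1) ^ 2 < d j
lemma1 (suc (suc (suc (suc (suc n))))) (s≤s (s≤s (s≤s (s≤s (s≤s _)))))
  with b , 3+b≡e ← m≤n⇒∃[o]m+o≡n (d[3+n]/[3+n]≥3 n) =
  subst (λ e → 2 * (m ^ e) ^ 2 < suc m ^ (m ^ e / m)) 3+b≡e
        (2*[m^[3+b]]^2<[1+m]^[m^[3+b]/m] m b (m≤m+n 4 n))
  where
  m = 4 + n
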